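{- Let $G$ be a graph and let $W$ be a long AW in $G$ with shallow terminal $s$, center(s) $c_1,c_2$ (with $c_1=c_2=c$ for a $\dagger$-AW), base vertices $b_1,\dots,b_d$ ($d\ge4$), base terminals $l=b_0$, $r=b_{d+1}$, and $h=b_1$, $t=b_d$. If an interval supergraph $\widehat G$ of $G$ contains none of the edges $l c_2, c_1 r, h t, s h, s t$, then in any interval representation $\{I_v\}_{v\in V(G)}$ of $\widehat G$ by closed intervals, the interval $I_s$ lies between $I_h$ and $I_t$: the intervals $I_h,I_s,I_t$ are pairwise disjoint and $I_s$ lies to the right of one of $I_h,I_t$ and to the left of the other.
   Context: Graphs are finite, simple, undirected. An interval supergraph of $G$ is an interval graph $\widehat G$ on $V(G)$ with $E(G)\subseteq E(\widehat G)$; an interval representation assigns to each vertex a closed interval so that vertices are adjacent iff their intervals intersect. A $\dagger$-AW with parameter $d\ge 2$ is the graph with vertices $s,c,b_0,\dots,b_{d+1}$ and exactly the edges $b_ib_{i+1}$ ($0\le i\le d$), $cs$, $cb_i$ ($1\le i\le d$). A $\ddagger$-AW with parameter $d\ge1$ has vertices $s,c_1,c_2,b_0,\dots,b_{d+1}$ and exactly the edges $b_ib_{i+1}$ ($0\le i\le d$), $c_1c_2$, $c_1s$, $c_2s$, $c_jb_i$ ($j=1,2$, $1\le i\le d$), $c_1b_0$, $c_2b_{d+1}$. A long AW in $G$ is an induced subgraph isomorphic to a $\dagger$- or $\ddagger$-AW with $d\ge4$; $s$ is its shallow terminal, $c$ / $c_1,c_2$ its center(s), $b_1,\dots,b_d$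 its base, $b_0,b_{d+1}$ its base terminals. -}

module Defs where

open import Level using (Level; _⊔_)
open import Data.Nat using (ℕ; zero; suc; _≤_)
open import Data.Fin using (Fin; toℕ; fromℕ; inject₁)
import Data.Fin as F
open import Data.Product using (_×_; Σ)
open import Data.Sum using (_⊎_)
open import Data.Unit using (⊤)
open import Data.Empty using (⊥)
open import Relation.Nullary using (¬_)
open import Relation.Binary.PropositionalEquality using (_≡_; _≢_)
open import Relation.Binary.Bundles using (StrictTotalOrder)
open import Function.Definitions using (Injective)
open import Function.Bundles using (_⇔_)

record Graph (n : ℕ) : Set₁ where
  field
    Adj     : Fin n → Fin n → Set
    sym     : ∀ {u v} → Adj u v → Adj v u
    irrefl  : ∀ {u} → ¬ Adj u u
open Graph public

_⊆ᴱ_ : ∀ {n} → Graph n → Graph n → Set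
G ⊆ᴱ H = ∀ {u v} → Adj G u v → Adj H u v

-- The abstract †-AW and ‡-AW with parameter d
-- (base vertices b₀ … b_{d+1} indexed by Fin (d+2))

Inner : (d : ℕ) → Fin (suc (suc d)) → Set
Inner d i = 1 ≤ toℕ i × toℕ i ≤ d

Consec : ∀ {m} → Fin m → Fin m → Set
Consec i j = suc (toℕ i) ≡ toℕ j ⊎ suc (toℕ j) ≡ toℕ i

data DagV (d : ℕ) : Set where
  s c : DagV d
  b   : Fin (suc (suc d)) → DagV d

DagAdj : (d : ℕ) → DagV d → DagV d → Set
DagAdj d s     c     = ⊤
DagAdj d c     s     = ⊤
DagAdj d c     (b i) = Inner d i
DagAdj d (b i) c     = Inner d i
DagAdj d (b i) (b j) = Consec i j
DagAdj d _     _     = ⊥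

data DDagV (d : ℕ) : Set where
  s c₁ c₂ : DDagV d
  b       : Fin (suc (suc d)) → DDagV d

C₁B : (d : ℕ) → Fin (suc (suc d)) → Set
C₁B d i = Inner d i ⊎ toℕ i ≡ 0

C₂B : (d : ℕ) → Fin (suc (suc d)) → Set
C₂B d i = Inner d i ⊎ toℕ i ≡ suc d

DDagAdj : (d : ℕ) → DDagV d → DDagV d → Set
DDagAdj d c₁    c₂    = ⊤
DDagAdj d c₂    c₁    = ⊤
DDagAdj d c₁    s     = ⊤
DDagAdj d s     c₁    = ⊤
DDagAdj d c₂    s     = ⊤
DDagAdj d s     c₂    = ⊤
DDagAdj d c₁    (b i) = C₁B d i
DDagAdj d (b i) c₁    = C₁B d i
DDagAdj d c₂    (b i) = C₂B d i
DDagAdj d (b i) c₂    = C₂B d i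
DDagAdj d (b i) (b j) = Consec i j
DDagAdj d _     _     = ⊥

record DagAW {n : ℕ} (G : Graph n) : Set where
  field
    d       : ℕ
    d≥4     : 4 ≤ d
    f       : DagV d → Fin n
    inj     : Injective _≡_ _≡_ f
    induced : ∀ x y → Adj G (f x) (f y) ⇔ DagAdj d x y

record DDagAW {n : ℕ} (G : Graph n) : Set where
  field
    d       : ℕ
    d≥4     : 4 ≤ d
    f       : DDagV d → Fin n
    inj     : Injective _≡_ _≡_ f
    induced : ∀ x y → Adj G (f x) (f y) ⇔ DDagAdj d x y

data LongAW {n : ℕ} (G : Graph n) : Set where
  dagger  : DagAW G  → LongAW G
  ddagger : DDagAW G → LongAW G

module _ {n : ℕ} {G : Graph n} where

  shallow : LongAW G → Fin n
  shallow (dagger W)  = DagAW.f W s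
  shallow (ddagger W) = DDagAW.f W s

  center₁ center₂ : LongAW G → Fin n
  center₁ (dagger W)  = DagAW.f W c
  center₁ (ddagger W) = DDagAW.f W c₁
  center₂ (dagger W)  = DagAW.f W c
  center₂ (ddagger W) = DDagAW.f W c₂

  awd : LongAW G → ℕ
  awd (dagger W)  = DagAW.d W
  awd (ddagger W) = DDagAW.d W

  base : (W : LongAW G) → Fin (suc (suc (awd W))) → Fin n
  base (dagger W)  i = DagAW.f W (b i)
  base (ddagger W) i = DDagAW.f W (b i)

  lT hB tB rT : LongAW G → Fin n
  lT W = base W F.zero
  hB W = base W (F.suc F.zero)
  tB W = base W (inject₁ (fromℕ (awd W)))
  rT W = base W (fromℕ (suc (awd W)))

-- Closed intervals over an arbitrary strict total order
-- (covers ℝ; the statement is quantified over all such orders)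

module Intervals {a ℓ₁ ℓ₂ : Level} (O : StrictTotalOrder a ℓ₁ ℓ₂) where
  open StrictTotalOrder O renaming (Carrier to X)

  record Interval : Set (a ⊔ ℓ₁ ⊔ ℓ₂) where
    constructor [_,_]⟨_⟩
    field
      lo hi : X
      lo≤hi : lo < hi ⊎ lo ≈ hi
  open Interval public

  Meets : Interval → Interval → Set ℓ₂
  Meets I J = ¬ (hi I < lo J) × ¬ (hi J < lo I)

  LeftOf : Interval → Interval → Set ℓ₂
  LeftOf I J = hi I < lo J

  IsIntervalRep : ∀ {n} → Graph n → (Fin n → Interval) → Set (ℓ₂)
  IsIntervalRep H I = ∀ u v → u ≢ v → Adj H u v ⇔ Meets (I u) (I v)

-- Since h, s, t are pairwise non-adjacent in Ĝ, their intervals are pairwise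
-- disjoint, so one of the three lies between the other two. Both centers are
-- adjacent to all of h, s, t, so each center's interval covers whichever of
-- them lies in the middle. If h were in the middle, the interval of l, which
-- meets I_h, would meet I_{c₂}; if t were in the middle, I_r would meet I_{c₁}.
-- Both edges are excluded, so s is in the middle.
module Submission where

open import Defs
open import Level using (Level)
open import Data.Nat using (ℕ; suc; _≤_; z≤n; s≤s)
open import Data.Nat.Properties using (≤-trans; ≤-refl)
open import Data.Fin using (Fin; toℕ; fromℕ; inject₁)
import Data.Fin as F
open import Data.Fin.Properties using (toℕ-inject₁; toℕ-fromℕ)
open import Data.Product using (_×_; _,_; proj₁; proj₂)
open import Data.Sum using (_⊎_; inj₁; inj₂)
open import Data.Unit using (tt)
open import Relation.Nullary using (¬_; yes; no; contradiction)
open import Relation.Binary.Bundles using (StrictTotalOrder)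
open import Relation.Binary.Definitions using (tri<; tri≈; tri>)
open import Relation.Binary.PropositionalEquality as ≡ using (_≡_; _≢_; refl; cong)
open import Function.Base using (_∘_)
open import Function.Bundles using (Equivalence)

module IntervalOrder {a ℓ₁ ℓ₂ : Level} (O : StrictTotalOrder a ℓ₁ ℓ₂) where
  open Intervals O
  open StrictTotalOrder O renaming (trans to <-trans)

  ≮-<-trans : ∀ {x y z} → ¬ (y < x) → y < z → x < z
  ≮-<-trans {x} {y} y≮x y<z with compare x y
  ... | tri< x<y _ _ = <-trans x<y y<z
  ... | tri≈ _ x≈y _ = <-respˡ-≈ (Eq.sym x≈y) y<z
  ... | tri> _ _ y<x = contradiction y<x y≮x

  <-≮-trans : ∀ {x y z} → x < y → ¬ (z < y) → x < z
  <-≮-trans {y = y} {z} x<y z≮y with compare y z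
  ... | tri< y<z _ _ = <-trans x<y y<z
  ... | tri≈ _ y≈z _ = <-respʳ-≈ y≈z x<y
  ... | tri> _ _ z<y = contradiction z<y z≮y

  Meets-sym : ∀ {I J} → Meets I J → Meets J I
  Meets-sym (p , q) = q , p

  disjoint⇒ordered : ∀ I J → ¬ Meets I J → LeftOf I J ⊎ LeftOf J I
  disjoint⇒ordered I J I∩J=∅ with hi I <? lo J | hi J <? lo I
  ... | yes I<J | _       = inj₁ I<J
  ... | no _    | yes J<I = inj₂ J<I
  ... | no I≮J  | no J≮I  = contradiction (I≮J , J≮I) I∩J=∅

  Between : Interval → Interval → Interval → Set ℓ₂
  Between A M B = (LeftOf A M × LeftOf M B) ⊎ (LeftOf B M × LeftOf M A)

  one-between : ∀ A B C → ¬ Meets A B → ¬ Meets B C → ¬ Meets A C →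
                Between A B C ⊎ Between B A C ⊎ Between A C B
  one-between A B C AB BC AC =
    go (disjoint⇒ordered A B AB) (disjoint⇒ordered B C BC) (disjoint⇒ordered A C AC)
    where
    go : LeftOf A B ⊎ LeftOf B A → LeftOf B C ⊎ LeftOf C B → LeftOf A C ⊎ LeftOf C A →
         Between A B C ⊎ Between B A C ⊎ Between A C B
    go (inj₁ A<B) (inj₁ B<C) _          = inj₁ (inj₁ (A<B , B<C))
    go (inj₂ B<A) (inj₂ C<B) _          = inj₁ (inj₂ (C<B , B<A))
    go (inj₁ A<B) (inj₂ C<B) (inj₁ A<C) = inj₂ (inj₂ (inj₁ (A<C , C<B)))
    go (inj₁ A<B) (inj₂ C<B) (inj₂ C<A) = inj₂ (inj₁ (inj₂ (C<A , A<B)))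
    go (inj₂ B<A) (inj₁ B<C) (inj₁ A<C) = inj₂ (inj₁ (inj₁ (B<A , A<C)))
    go (inj₂ B<A) (inj₁ B<C) (inj₂ C<A) = inj₂ (inj₂ (inj₂ (B<C , C<A)))

  meets-cover : ∀ A M B X Y → Meets X A → Meets X B → Between A M B →
                Meets Y M → Meets Y X
  meets-cover A M B X Y XA XB (inj₁ (A<M , M<B)) YM =
    (λ Y<X → asym Y<X (<-≮-trans (≮-<-trans (proj₂ XA) A<M) (proj₁ YM))) ,
    (λ X<Y → asym X<Y (<-≮-trans (≮-<-trans (proj₂ YM) M<B) (proj₁ XB)))
  meets-cover A M B X Y XA XB (inj₂ B<M<A) YM = meets-cover B M A X Y XB XA (inj₁ B<M<A) YM

  middle-is-shallow : ∀ H S T L R C₁ C₂ →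
    ¬ Meets H S → ¬ Meets S T → ¬ Meets H T →
    Meets C₁ H → Meets C₁ S → Meets C₂ S → Meets C₂ T → Meets L H → Meets R T →
    ¬ Meets L C₂ → ¬ Meets C₁ R → Between H S T
  middle-is-shallow H S T L R C₁ C₂ HS ST HT C₁H C₁S C₂S C₂T LH RT LC₂ C₁R
    with one-between H S T HS ST HT
  ... | inj₁ H<S<T         = H<S<T
  ... | inj₂ (inj₁ S<H<T) = contradiction (meets-cover S H T C₂ L C₂S C₂T S<H<T LH) LC₂
  ... | inj₂ (inj₂ H<T<S) =
    contradiction (Meets-sym {R} {C₁} (meets-cover H T S C₁ R C₁H C₁S H<T<S RT)) C₁R

-- All the proof uses of a long AW; these facts already hold for d ≥ 2.
record Frame {n : ℕ} (G : Graph n) (l h s t r c₁ c₂ : Fin n) : Set where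
  field
    c₁∼h : Adj G c₁ h
    c₁∼s : Adj G c₁ s
    c₂∼s : Adj G c₂ s
    c₂∼t : Adj G c₂ t
    l∼h  : Adj G l h
    r∼t  : Adj G r t
    s≢h  : s ≢ h
    s≢t  : s ≢ t
    h≢t  : h ≢ t
    l≢c₂ : l ≢ c₂
    c₁≢r : c₁ ≢ r

frame-mono : ∀ {n} {G H : Graph n} {l h s t r c₁ c₂} → G ⊆ᴱ H →
             Frame G l h s t r c₁ c₂ → Frame H l h s t r c₁ c₂
frame-mono G⊆H F = record
  { c₁∼h = G⊆H c₁∼h ; c₁∼s = G⊆H c₁∼s ; c₂∼s = G⊆H c₂∼s ; c₂∼t = G⊆H c₂∼t
  ; l∼h = G⊆H l∼h ; r∼t = G⊆H r∼t
  ; s≢h = s≢h ; s≢t = s≢t ; h≢t = h≢t ; l≢c₂ = l≢c₂ ; c₁≢r = c₁≢r }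
  where open Frame F

module Representation {a ℓ₁ ℓ₂ : Level} (O : StrictTotalOrder a ℓ₁ ℓ₂)
  {n : ℕ} (H : Graph n) (I : Fin n → Intervals.Interval O)
  (rep : Intervals.IsIntervalRep O H I) where
  open Intervals O
  open IntervalOrder O

  adj⇒meets : ∀ {u v} → Adj H u v → Meets (I u) (I v)
  adj⇒meets {u} {v} u∼v = Equivalence.to (rep u v λ { refl → irrefl H u∼v }) u∼v

  nonadj⇒disjoint : ∀ {u v} → u ≢ v → ¬ Adj H u v → ¬ Meets (I u) (I v)
  nonadj⇒disjoint {u} {v} u≢v u≁v = u≁v ∘ Equivalence.from (rep u v u≢v)

  module _ {l h s t r c₁ c₂ : Fin n} (F : Frame H l h s t r c₁ c₂) where
    open Frame F

    frame-shallow-between :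
      ¬ Adj H l c₂ → ¬ Adj H c₁ r → ¬ Adj H h t → ¬ Adj H s h → ¬ Adj H s t →
      (¬ Meets (I h) (I s) × ¬ Meets (I s) (I t) × ¬ Meets (I h) (I t)) ×
      Between (I h) (I s) (I t)
    frame-shallow-between l≁c₂ c₁≁r h≁t s≁h s≁t =
      (hs , st , ht) ,
      middle-is-shallow (I h) (I s) (I t) (I l) (I r) (I c₁) (I c₂) hs st ht
        (adj⇒meets c₁∼h) (adj⇒meets c₁∼s) (adj⇒meets c₂∼s) (adj⇒meets c₂∼t)
        (adj⇒meets l∼h) (adj⇒meets r∼t)
        (nonadj⇒disjoint l≢c₂ l≁c₂) (nonadj⇒disjoint c₁≢r c₁≁r)
      where
      hs : ¬ Meets (I h) (I s)
      hs = nonadj⇒disjoint s≢h s≁h ∘ Meets-sym {I h} {I s}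
      st : ¬ Meets (I s) (I t)
      st = nonadj⇒disjoint s≢t s≁t
      ht : ¬ Meets (I h) (I t)
      ht = nonadj⇒disjoint h≢t h≁t

module _ {d : ℕ} where
  toℕ-last : toℕ (inject₁ (fromℕ d)) ≡ d
  toℕ-last = ≡.trans (toℕ-inject₁ (fromℕ d)) (toℕ-fromℕ d)

  inner-first : 1 ≤ d → Inner d (F.suc F.zero)
  inner-first 1≤d = ≤-refl , 1≤d

  inner-last : 1 ≤ d → Inner d (inject₁ (fromℕ d))
  inner-last 1≤d rewrite toℕ-last = 1≤d , ≤-refl

  consec-last : Consec (fromℕ (suc d)) (inject₁ (fromℕ d))
  consec-last = inj₂ (≡.trans (cong suc toℕ-last) (≡.sym (toℕ-fromℕ (suc d))))

first≢last : ∀ {d} → 2 ≤ d → F.suc F.zero ≢ inject₁ {suc d} (fromℕ d)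
first≢last {suc (suc d)} (s≤s (s≤s _)) ()

module _ {n : ℕ} {G : Graph n} where
  longAW-frame : (W : LongAW G) →
    Frame G (lT W) (hB W) (shallow W) (tB W) (rT W) (center₁ W) (center₂ W)
  longAW-frame (dagger W) = record
    { c₁∼h = edge c (b _) (inner-first 1≤d)
    ; c₁∼s = edge c s tt
    ; c₂∼s = edge c s tt
    ; c₂∼t = edge c (b _) (inner-last 1≤d)
    ; l∼h  = edge (b _) (b _) (inj₁ refl)
    ; r∼t  = edge (b _) (b _) consec-last
    ; s≢h  = λ e → contradiction (inj e) λ ()
    ; s≢t  = λ e → contradiction (inj e) λ ()
    ; h≢t  = λ e → first≢last 2≤d (b-injective (inj e))
    ; l≢c₂ = λ e → contradiction (inj e) λ ()
    ; c₁≢r = λ e → contradiction (inj e) λ ()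
    }
    where
    open DagAW W
    edge : ∀ x y → DagAdj d x y → Adj G (f x) (f y)
    edge x y = Equivalence.from (induced x y)
    b-injective : ∀ {i j} → DagV.b {d} i ≡ b j → i ≡ j
    b-injective refl = refl
    1≤d : 1 ≤ d
    1≤d = ≤-trans (s≤s z≤n) d≥4
    2≤d : 2 ≤ d
    2≤d = ≤-trans (s≤s (s≤s z≤n)) d≥4
  longAW-frame (ddagger W) = record
    { c₁∼h = edge c₁ (b _) (inj₁ (inner-first 1≤d))
    ; c₁∼s = edge c₁ s tt
    ; c₂∼s = edge c₂ s tt
    ; c₂∼t = edge c₂ (b _) (inj₁ (inner-last 1≤d))
    ; l∼h  = edge (b _) (b _) (inj₁ refl)
    ; r∼t  = edge (b _) (b _) consec-last
    ; s≢h  = λ e → contradiction (inj e) λ ()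
    ; s≢t  = λ e → contradiction (inj e) λ ()
    ; h≢t  = λ e → first≢last 2≤d (b-injective (inj e))
    ; l≢c₂ = λ e → contradiction (inj e) λ ()
    ; c₁≢r = λ e → contradiction (inj e) λ ()
    }
    where
    open DDagAW W
    edge : ∀ x y → DDagAdj d x y → Adj G (f x) (f y)
    edge x y = Equivalence.from (induced x y)
    b-injective : ∀ {i j} → DDagV.b {d} i ≡ b j → i ≡ j
    b-injective refl = refl
    1≤d : 1 ≤ d
    1≤d = ≤-trans (s≤s z≤n) d≥4
    2≤d : 2 ≤ d
    2≤d = ≤-trans (s≤s (s≤s z≤n)) d≥4

corollary1 : {a ℓ₁ ℓ₂ : Level} (O : StrictTotalOrder a ℓ₁ ℓ₂) →
    let open Intervals O in
    {n : ℕ} (G Ĝ : Graph n) (W : LongAW G) →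
    G ⊆ᴱ Ĝ →
    ¬ Adj Ĝ (lT W) (center₂ W) →
    ¬ Adj Ĝ (center₁ W) (rT W) →
    ¬ Adj Ĝ (hB W) (tB W) →
    ¬ Adj Ĝ (shallow W) (hB W) →
    ¬ Adj Ĝ (shallow W) (tB W) →
    (I : Fin n → Interval) → IsIntervalRep Ĝ I →
    (¬ Meets (I (hB W)) (I (shallow W)) ×
     ¬ Meets (I (shallow W)) (I (tB W)) ×
     ¬ Meets (I (hB W)) (I (tB W))) ×
    ((LeftOf (I (hB W)) (I (shallow W)) × LeftOf (I (shallow W)) (I (tB W))) ⊎
     (LeftOf (I (tB W)) (I (shallow W)) × LeftOf (I (shallow W)) (I (hB W))))
corollary1 O G Ĝ W G⊆Ĝ l≁c₂ c₁≁r h≁t s≁h s≁t I rep =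
  Representation.frame-shallow-between O Ĝ I rep (frame-mono G⊆Ĝ (longAW-frame W))
    l≁c₂ c₁≁r h≁t s≁h s≁t
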